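{- Let $k$ be a positive integer and let $G$ be a $k$-colourable $3K_1$-free graph. In any $(k+1)$-colouring of $G$, there exists a colour $c \in \{1,\dots,k+1\}$ that either is used on no vertex of $G$ or is used on exactly one vertex of $G$.
   Context: All graphs are finite and simple. A graph is $3K_1$-free if it has no stable set of three vertices. A $k$-colouring of $G$ is a map $\alpha: V(G)\to\{1,\dots,k\}$ with $\alpha(u)\ne\alpha(v)$ for every edge $uv$. -}

module Defs where

open import Data.Nat using (ℕ; suc)
open import Data.Fin using (Fin)
open import Data.Product using (Σ; _×_; ∃)
open import Data.Sum using (_⊎_)
open import Relation.Nullary using (¬_; Dec)
open import Relation.Binary.PropositionalEquality using (_≡_; _≢_)
open import Level using (0ℓ; suc)

record Graph (n : ℕ) : Set₁ where
  field
    Adj     : Fin n → Fin n → Set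
    adj?    : ∀ u v → Dec (Adj u v)
    irrefl  : ∀ v → ¬ Adj v v
    sym     : ∀ {u v} → Adj u v → Adj v u
open Graph public

ThreeK1Free : ∀ {n} → Graph n → Set
ThreeK1Free {n} G =
  ∀ (u v w : Fin n) → u ≢ v → u ≢ w → v ≢ w →
  ¬ (¬ Adj G u v × ¬ Adj G u w × ¬ Adj G v w)

-- A k-colouring: map into k colours (Fin k stands for {1,…,k}) that is
-- proper on every edge.
IsColouring : ∀ {n} → Graph n → (k : ℕ) → (Fin n → Fin k) → Set
IsColouring {n} G k α = ∀ (u v : Fin n) → Adj G u v → α u ≢ α v

Colourable : ∀ {n} → Graph n → ℕ → Set
Colourable {n} G k = Σ (Fin n → Fin k) (IsColouring G k)

Unused : ∀ {n m} → (Fin n → Fin m) → Fin m → Set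
Unused {n} α c = ∀ (v : Fin n) → α v ≢ c

UsedOnce : ∀ {n m} → (Fin n → Fin m) → Fin m → Set
UsedOnce {n} α c = Σ (Fin n) λ v → α v ≡ c × (∀ (u : Fin n) → α u ≡ c → u ≡ v)

-- A proper colouring of a 3K₁-free graph has colour classes of size at most two,
-- since a colour class is a stable set. So a k-colouring forces n ≤ 2k, while a
-- (k+1)-colouring in which every colour is used at least twice forces 2(k+1) ≤ n.
module Submission where

open import Defs hiding (sym)
open import Data.Nat using (ℕ; suc; NonZero)
open import Data.Fin using (Fin)
open import Data.Product using (Σ)
open import Data.Sum using (_⊎_)

open import Data.Nat using (_*_; _≤_)
open import Data.Nat.Properties using (≤-trans; n≤1+n; ≤⇒≯)
open import Data.Fin using (zero; suc; _<_; combine; remQuot)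
open import Data.Fin.Properties
  using (any?; _<?_; _≟_; <-cmp; <-trans; <⇒≢; injective⇒≤; combine-injective; combine-remQuot)
open import Data.Product using (_×_; _,_; ∃; ∃₂; proj₁; proj₂; uncurry)
open import Data.Product.Properties using (,-injectiveˡ; ,-injectiveʳ)
open import Data.Sum using (inj₁; inj₂)
open import Data.Empty using (⊥; ⊥-elim)
open import Function.Definitions using (Injective)
open import Relation.Nullary using (¬_; Dec; yes; no)
open import Relation.Nullary.Decidable using (_×-dec_; ¬?)
open import Relation.Binary using (tri<; tri≈; tri>)
open import Relation.Binary.PropositionalEquality using (_≡_; _≢_; refl; sym; trans; cong; cong₂)

private
  variable
    m n p : ℕ

injective⇒*≤ : (f : Fin m × Fin n → Fin p) → Injective _≡_ _≡_ f → m * n ≤ p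
injective⇒*≤ {m = m} {n = n} f f-inj = injective⇒≤ (λ e → remQuot-injective (f-inj e))
  where
  remQuot-injective : ∀ {i j} → remQuot {m} n i ≡ remQuot n j → i ≡ j
  remQuot-injective {i} {j} e =
    trans (sym (combine-remQuot {m} n i)) (trans (cong (uncurry combine) e) (combine-remQuot {m} n j))

injective⇒≤* : (f : Fin p → Fin m × Fin n) → Injective _≡_ _≡_ f → p ≤ m * n
injective⇒≤* {m = m} {n = n} f f-inj = injective⇒≤ (λ e → f-inj (combine-injective′ e))
  where
  combine-injective′ : ∀ {i j k l} → combine {m} {n} i j ≡ combine k l → (i , j) ≡ (k , l)
  combine-injective′ {i} {j} {k} {l} e =
    let i≡k , j≡l = combine-injective {m} {n} i j k l e in cong₂ _,_ i≡k j≡l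

NoThreeInFibre : (Fin n → Fin m) → Set
NoThreeInFibre {n} f =
  ∀ {x y z : Fin n} → x ≢ y → x ≢ z → y ≢ z → f x ≡ f y → f y ≡ f z → ⊥

colouring-noThreeInFibre : (G : Graph n) → ThreeK1Free G →
                           (γ : Fin n → Fin m) → IsColouring G m γ → NoThreeInFibre γ
colouring-noThreeInFibre G free γ proper {x} {y} {z} x≢y x≢z y≢z γx≡γy γy≡γz =
  free x y z x≢y x≢z y≢z
    (nonadjacent γx≡γy , nonadjacent (trans γx≡γy γy≡γz) , nonadjacent γy≡γz)
  where
  nonadjacent : ∀ {u v} → γ u ≡ γ v → ¬ Adj G u v
  nonadjacent γu≡γv uv = proper _ _ uv γu≡γv

-- Tagging each vertex by whether an earlier vertex lies in its fibre separates
-- the (at most two) elements of every fibre.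
module _ (f : Fin n → Fin m) (f-fibres : NoThreeInFibre f) where

  HasEarlierTwin : Fin n → Set
  HasEarlierTwin v = ∃ λ w → w < v × f w ≡ f v

  hasEarlierTwin? : ∀ v → Dec (HasEarlierTwin v)
  hasEarlierTwin? v = any? (λ w → (w <? v) ×-dec (f w ≟ f v))

  twinTag : ∀ {v} → Dec (HasEarlierTwin v) → Fin 2
  twinTag (yes _) = suc zero
  twinTag (no _)  = zero

  tag : Fin n → Fin 2
  tag v = twinTag (hasEarlierTwin? v)

  tag-separates : ∀ {u v} → u < v → f u ≡ f v → tag u ≢ tag v
  tag-separates {u} {v} u<v fu≡fv with hasEarlierTwin? u | hasEarlierTwin? v
  ... | yes (w , w<u , fw≡fu) | _ =
    ⊥-elim (f-fibres (<⇒≢ w<u) (<⇒≢ (<-trans w<u u<v)) (<⇒≢ u<v) fw≡fu fu≡fv)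
  ... | no _ | yes _      = λ ()
  ... | no _ | no ¬twin   = ⊥-elim (¬twin (u , u<v , fu≡fv))

  value-tag-injective : Injective _≡_ _≡_ (λ v → f v , tag v)
  value-tag-injective {u} {v} e with <-cmp u v
  ... | tri< u<v _ _ = ⊥-elim (tag-separates u<v (,-injectiveˡ e) (,-injectiveʳ e))
  ... | tri≈ _ u≡v _ = u≡v
  ... | tri> _ _ v<u = ⊥-elim (tag-separates v<u (sym (,-injectiveˡ e)) (sym (,-injectiveʳ e)))

  noThreeInFibre⇒≤*2 : n ≤ m * 2
  noThreeInFibre⇒≤*2 = injective⇒≤* (λ v → f v , tag v) value-tag-injective

module _ (α : Fin n → Fin m) where

  UsedAtMostOnce : Fin m → Set
  UsedAtMostOnce c = Unused α c ⊎ UsedOnce α c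

  UsedTwice : Fin m → Set
  UsedTwice c = ∃₂ λ a b → a ≢ b × α a ≡ c × α b ≡ c

  usedAtMostOnce⊎usedTwice : ∀ c → UsedAtMostOnce c ⊎ UsedTwice c
  usedAtMostOnce⊎usedTwice c with any? (λ v → α v ≟ c)
  ... | no ¬used = inj₁ (inj₁ (λ v αv≡c → ¬used (v , αv≡c)))
  ... | yes (a , αa≡c) with any? (λ b → ¬? (a ≟ b) ×-dec (α b ≟ c))
  ...   | yes (b , a≢b , αb≡c) = inj₂ (a , b , a≢b , αa≡c , αb≡c)
  ...   | no ¬other = inj₁ (inj₂ (a , αa≡c , only-a))
    where
    only-a : ∀ u → α u ≡ c → u ≡ a
    only-a u αu≡c with a ≟ u
    ... | yes a≡u = sym a≡u
    ... | no a≢u  = ⊥-elim (¬other (u , a≢u , αu≡c))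

  usedTwice⇒¬usedAtMostOnce : ∀ {c} → UsedTwice c → ¬ UsedAtMostOnce c
  usedTwice⇒¬usedAtMostOnce (a , b , a≢b , αa≡c , αb≡c) (inj₁ unused) = unused a αa≡c
  usedTwice⇒¬usedAtMostOnce (a , b , a≢b , αa≡c , αb≡c) (inj₂ (v , _ , only-v)) =
    a≢b (trans (only-v a αa≡c) (sym (only-v b αb≡c)))

  usedAtMostOnce? : ∀ c → Dec (UsedAtMostOnce c)
  usedAtMostOnce? c with usedAtMostOnce⊎usedTwice c
  ... | inj₁ once  = yes once
  ... | inj₂ twice = no (usedTwice⇒¬usedAtMostOnce twice)

  allUsedTwice⇒*2≤ : (∀ c → UsedTwice c) → m * 2 ≤ n
  allUsedTwice⇒*2≤ twice = injective⇒*≤ (uncurry pick) pick-injective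
    where
    pick : Fin m → Fin 2 → Fin n
    pick c zero       = proj₁ (twice c)
    pick c (suc zero) = proj₁ (proj₂ (twice c))

    pick-colour : ∀ c t → α (pick c t) ≡ c
    pick-colour c zero       = proj₁ (proj₂ (proj₂ (proj₂ (twice c))))
    pick-colour c (suc zero) = proj₂ (proj₂ (proj₂ (proj₂ (twice c))))

    pick-distinct : ∀ c → pick c zero ≢ pick c (suc zero)
    pick-distinct c = proj₁ (proj₂ (proj₂ (twice c)))

    pick-injectiveʳ : ∀ c {t t′} → pick c t ≡ pick c t′ → t ≡ t′
    pick-injectiveʳ c {zero}     {zero}     _ = refl
    pick-injectiveʳ c {suc zero} {suc zero} _ = refl
    pick-injectiveʳ c {zero}     {suc zero} e = ⊥-elim (pick-distinct c e)
    pick-injectiveʳ c {suc zero} {zero}     e = ⊥-elim (pick-distinct c (sym e))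

    pick-injective : Injective _≡_ _≡_ (uncurry pick)
    pick-injective {c , t} {c′ , t′} e
      with trans (sym (pick-colour c t)) (trans (cong α e) (pick-colour c′ t′))
    ... | refl = cong (c ,_) (pick-injectiveʳ c e)

lemma7 : (k : ℕ) → .{{_ : NonZero k}} → (n : ℕ) → (G : Graph n) →
    Colourable G k → ThreeK1Free G →
    (α : Fin n → Fin (suc k)) → IsColouring G (suc k) α →
    Σ (Fin (suc k)) (λ c → Unused α c ⊎ UsedOnce α c)
lemma7 k n G (β , β-proper) free α α-proper with any? (usedAtMostOnce? α)
... | yes rare = rare
... | no ¬rare = ⊥-elim (≤⇒≯ n≤2k (≤-trans (n≤1+n _) 2k+2≤n))
  where
  n≤2k : n ≤ k * 2
  n≤2k = noThreeInFibre⇒≤*2 β (colouring-noThreeInFibre G free β β-proper)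

  allUsedTwice : ∀ c → UsedTwice α c
  allUsedTwice c with usedAtMostOnce⊎usedTwice α c
  ... | inj₁ once  = ⊥-elim (¬rare (c , once))
  ... | inj₂ twice = twice

  2k+2≤n : suc k * 2 ≤ n
  2k+2≤n = allUsedTwice⇒*2≤ α allUsedTwice
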